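{- Let $n\ge 3$ and $L_n^{(t)}(x)=\sum_{j=0}^n (-x)^j \binom{n}{j}\prod_{k=j+1}^n (t+k)$. Then the affine plane curve in the $(x,t)$-plane over an algebraically closed field of characteristic $0$ defined by $L_n^{(t)}(x)=0$ has no singular point.
   Context: Equivalently, the projective closure $\mathcal{L}_n$ of this curve (given by the homogenization in $x,t$ and a third variable $\mu$) has no singular point with $\mu\neq 0$. -}

module Defs where

open import Level using (_⊔_)
open import Algebra.Bundles using (CommutativeRing)
open import Data.Nat using (ℕ; zero; suc; _∸_)
import Data.Nat as ℕ
open import Data.Nat.Combinatorics using (_C_)
open import Data.List using (List; []; _∷_; _++_)
open import Data.Product using (∃; _×_)
open import Relation.Nullary using (¬_)

data Expr : Set where
  con  : ℕ → Expr
  varX : Expr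
  varT : Expr
  _⊕_  : Expr → Expr → Expr
  _⊗_  : Expr → Expr → Expr
  neg  : Expr → Expr

infixl 6 _⊕_
infixl 7 _⊗_

powE : Expr → ℕ → Expr
powE e zero = con 1
powE e (suc j) = powE e j ⊗ e

∂x : Expr → Expr
∂x (con _) = con 0
∂x varX = con 1
∂x varT = con 0
∂x (a ⊕ b) = ∂x a ⊕ ∂x b
∂x (a ⊗ b) = ∂x a ⊗ b ⊕ a ⊗ ∂x b
∂x (neg a) = neg (∂x a)

∂t : Expr → Expr
∂t (con _) = con 0
∂t varX = con 0
∂t varT = con 1
∂t (a ⊕ b) = ∂t a ⊕ ∂t b
∂t (a ⊗ b) = ∂t a ⊗ b ⊕ a ⊗ ∂t b
∂t (neg a) = neg (∂t a)

-- prodShift j m = ∏_{i=1}^{m} (t + (j + i)),  so that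
-- prodShift j (n ∸ j) = ∏_{k=j+1}^{n} (t + k)
prodShift : ℕ → ℕ → Expr
prodShift j zero = con 1
prodShift j (suc m) = prodShift j m ⊗ (varT ⊕ con (j ℕ.+ suc m))

Lterm : ℕ → ℕ → Expr
Lterm n j = powE (neg varX) j ⊗ con (n C j) ⊗ prodShift j (n ∸ j)

sumUpTo : (ℕ → Expr) → ℕ → Expr
sumUpTo f zero = f zero
sumUpTo f (suc m) = sumUpTo f m ⊕ f (suc m)

L : ℕ → Expr
L n = sumUpTo (Lterm n) n

module _ {c ℓ} (K : CommutativeRing c ℓ) where
  open CommutativeRing K

  nat : ℕ → Carrier
  nat zero = 0#
  nat (suc n) = 1# + nat n

  eval : Expr → Carrier → Carrier → Carrier
  eval (con k) x t = nat k
  eval varX x t = x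
  eval varT x t = t
  eval (a ⊕ b) x t = eval a x t + eval b x t
  eval (a ⊗ b) x t = eval a x t * eval b x t
  eval (neg a) x t = - eval a x t

  record IsField : Set (c ⊔ ℓ) where
    field
      nontrivial : ¬ (1# ≈ 0#)
      inverse    : ∀ a → ¬ (a ≈ 0#) → ∃ λ b → a * b ≈ 1#

  CharZero : Set ℓ
  CharZero = ∀ n → ¬ (nat (suc n) ≈ 0#)

  evalU : List Carrier → Carrier → Carrier
  evalU [] x = 0#
  evalU (a ∷ as) x = a + x * evalU as x

  -- every polynomial a₀ + a₁ y + … + a_d y^d with d ≥ 1 and a_d ≠ 0 has a root
  IsAlgClosed : Set (c ⊔ ℓ)
  IsAlgClosed = ∀ (a₀ : Carrier) (as : List Carrier) (a : Carrier) →
                ¬ (a ≈ 0#) → ∃ λ y → evalU (a₀ ∷ as ++ a ∷ []) y ≈ 0#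

  SingularPoint : Expr → Carrier → Carrier → Set ℓ
  SingularPoint f x t =
    eval f x t ≈ 0# × eval (∂x f) x t ≈ 0# × eval (∂t f) x t ≈ 0#

{-# OPTIONS --safe #-}
module Submission where

-- Write L n = Σⱼ aⱼ (-x)ʲ with aⱼ = binom(n,j) ∏_{k=j+1}^n (t+k). The coefficients satisfy
-- (j+1)(j+1+t) a_{j+1} + j aⱼ = n aⱼ, so y(u) = Σ aⱼ uʲ solves u y'' + (t+1+u) y' = n y, and y'
-- solves the same equation with (t, n) replaced by (t+1, n-1). Where u = -x ≠ 0, y(u) = y'(u) = 0
-- forces y''(u) = 0, so by induction on n the constant n-th derivative n! aₙ = n! would vanish,
-- which characteristic 0 excludes. On the axis x = 0, L n = ∏_{k=1}^n (t+k) has the distinct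
-- roots -1, …, -n, so L n and ∂L n/∂t do not vanish together there.

open import Defs
open import Algebra.Bundles using (CommutativeRing)
open import Data.Nat using (ℕ; zero; suc; _∸_; _<_; _≤_; s≤s; z≤n; _<?_)
import Data.Nat as ℕ
import Data.Nat.Properties as ℕₚ
open import Data.Nat.Solver using (module +-*-Solver)
open import Data.Nat.Combinatorics
  using (_C_; nC1≡n; nCn≡1; k>n⇒nCk≡0; nCk+nC[k+1]≡[n+1]C[k+1])
open import Data.Product using (_,_; _×_)
open import Function using (_∘_)
open import Relation.Nullary using (¬_; yes; no)
open import Relation.Nullary.Decidable using (¬¬-excluded-middle)
open import Relation.Binary.PropositionalEquality as ≡ using (_≡_)

module _ where
  open import Data.Nat using (_+_; _*_)
  open import Data.Nat.Properties using (*-zeroʳ; +-identityʳ; *-identityˡ; *-identityʳ)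
  open ≡ using (refl; sym; trans; cong; cong₂; module ≡-Reasoning)

  binomial-recurrence : ∀ n j → suc j * (n C suc j) + j * (n C j) ≡ n * (n C j)
  binomial-recurrence zero    zero    = refl
  binomial-recurrence zero    (suc j) = trans
    (cong₂ (λ a b → suc (suc j) * a + suc j * b)
           (k>n⇒nCk≡0 {0} {suc (suc j)} (s≤s z≤n)) (k>n⇒nCk≡0 {0} {suc j} (s≤s z≤n)))
    (cong₂ _+_ (*-zeroʳ (suc (suc j))) (*-zeroʳ (suc j)))
  binomial-recurrence (suc n) zero    =
    trans (+-identityʳ _) (trans (*-identityˡ _) (trans (nC1≡n (suc n)) (sym (*-identityʳ (suc n)))))
  binomial-recurrence (suc n) (suc j) = begin
    suc (suc j) * (suc n C suc (suc j)) + suc j * (suc n C suc j)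
      ≡⟨ cong₂ (λ a b → suc (suc j) * a + suc j * b) (sym (nCk+nC[k+1]≡[n+1]C[k+1] n (suc j)))
                                                       (sym (nCk+nC[k+1]≡[n+1]C[k+1] n j)) ⟩
    suc (suc j) * (B + A) + suc j * (C₀ + B)
      ≡⟨ solve 4 (λ j A B C₀ → (con 2 :+ j) :* (B :+ A) :+ (con 1 :+ j) :* (C₀ :+ B)
                   := ((con 2 :+ j) :* A :+ (con 1 :+ j) :* B) :+ ((con 1 :+ j) :* B :+ j :* C₀)
                      :+ (B :+ C₀))
                 refl j A B C₀ ⟩
    (suc (suc j) * A + suc j * B) + (suc j * B + j * C₀) + (B + C₀)
      ≡⟨ cong₂ (λ a b → a + b + (B + C₀)) (binomial-recurrence n (suc j)) (binomial-recurrence n j) ⟩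
    n * B + n * C₀ + (B + C₀)
      ≡⟨ solve 3 (λ n B C₀ → n :* B :+ n :* C₀ :+ (B :+ C₀) := (con 1 :+ n) :* (C₀ :+ B)) refl n B C₀ ⟩
    suc n * (C₀ + B)
      ≡⟨ cong (suc n *_) (nCk+nC[k+1]≡[n+1]C[k+1] n j) ⟩
    suc n * (suc n C suc j) ∎
    where
    open ≡-Reasoning
    open +-*-Solver
    A B C₀ : ℕ
    A  = n C suc (suc j)
    B  = n C suc j
    C₀ = n C j

record IsDerivation (∂ : Expr → Expr) : Set where
  field
    ∂-con : ∀ k → ∂ (con k) ≡ con 0
    ∂-⊕   : ∀ a b → ∂ (a ⊕ b) ≡ ∂ a ⊕ ∂ b
    ∂-⊗   : ∀ a b → ∂ (a ⊗ b) ≡ ∂ a ⊗ b ⊕ a ⊗ ∂ b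

∂x-isDerivation : IsDerivation ∂x
∂x-isDerivation = record { ∂-con = λ _ → ≡.refl ; ∂-⊕ = λ _ _ → ≡.refl ; ∂-⊗ = λ _ _ → ≡.refl }

∂t-isDerivation : IsDerivation ∂t
∂t-isDerivation = record { ∂-con = λ _ → ≡.refl ; ∂-⊕ = λ _ _ → ≡.refl ; ∂-⊗ = λ _ _ → ≡.refl }

∂-sumUpTo : ∀ {∂} → IsDerivation ∂ → ∀ F m → ∂ (sumUpTo F m) ≡ sumUpTo (∂ ∘ F) m
∂-sumUpTo     isD F zero    = ≡.refl
∂-sumUpTo {∂} isD F (suc m) =
  ≡.trans (IsDerivation.∂-⊕ isD _ _) (≡.cong (_⊕ ∂ (F (suc m))) (∂-sumUpTo isD F m))

module _ {c ℓ} (K : CommutativeRing c ℓ) where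
  open CommutativeRing K hiding (zero)
  open import Algebra.Properties.Semiring.Exp semiring using (_^_)
  open import Algebra.Properties.Semiring.Mult semiring
    using (×-homo-+; ×1-homo-*) renaming (_×_ to _×ₙ_)
  open import Algebra.Properties.Ring ring using (+-cancelʳ; -0#≈0#; -‿injective)
  open import Algebra.Properties.CommutativeSemigroup +-commutativeSemigroup
    using () renaming (interchange to +-interchange)
  open import Algebra.Properties.CommutativeSemigroup *-commutativeSemigroup
    using () renaming (x∙yz≈y∙xz to *-exchangeˡ)
  open import Algebra.Solver.Ring.NaturalCoefficients.Default commutativeSemiring
    using (solve; _:=_; _:+_; _:*_; con)
  open import Relation.Binary.Reasoning.Setoid setoid

  N : ℕ → Carrier
  N = nat K

  N≡×1# : ∀ n → N n ≡ n ×ₙ 1#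
  N≡×1# zero    = ≡.refl
  N≡×1# (suc n) = ≡.cong (1# +_) (N≡×1# n)

  N-+ : ∀ m n → N (m ℕ.+ n) ≈ N m + N n
  N-+ m n = begin
    N (m ℕ.+ n)          ≡⟨ N≡×1# (m ℕ.+ n) ⟩
    (m ℕ.+ n) ×ₙ 1#      ≈⟨ ×-homo-+ 1# m n ⟩
    m ×ₙ 1# + n ×ₙ 1#    ≡⟨ ≡.cong₂ _+_ (N≡×1# m) (N≡×1# n) ⟨
    N m + N n            ∎

  N-* : ∀ m n → N (m ℕ.* n) ≈ N m * N n
  N-* m n = begin
    N (m ℕ.* n)          ≡⟨ N≡×1# (m ℕ.* n) ⟩
    (m ℕ.* n) ×ₙ 1#      ≈⟨ ×1-homo-* m n ⟩
    m ×ₙ 1# * n ×ₙ 1#    ≡⟨ ≡.cong₂ _*_ (N≡×1# m) (N≡×1# n) ⟨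
    N m * N n            ∎

  N1*-identity : ∀ a → N 1 * a ≈ a
  N1*-identity a = trans (*-congʳ (+-identityʳ 1#)) (*-identityˡ a)

  x≈0⇒x*y≈0 : ∀ {x y} → x ≈ 0# → x * y ≈ 0#
  x≈0⇒x*y≈0 x≈0 = trans (*-congʳ x≈0) (zeroˡ _)

  y≈0⇒x*y≈0 : ∀ {x y} → y ≈ 0# → x * y ≈ 0#
  y≈0⇒x*y≈0 y≈0 = trans (*-congˡ y≈0) (zeroʳ _)

  -‿≉0 : ∀ {a} → ¬ a ≈ 0# → ¬ - a ≈ 0#
  -‿≉0 a≉0 -a≈0 = a≉0 (-‿injective (trans -a≈0 (sym -0#≈0#)))

  -- Polynomials as coefficient sequences

  -- The bound is inclusive, as for sumUpTo: ∑ f m = f 0 + ⋯ + f m.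
  ∑ : (ℕ → Carrier) → ℕ → Carrier
  ∑ f zero    = f zero
  ∑ f (suc m) = ∑ f m + f (suc m)

  ∑-cong : ∀ {f g} → (∀ j → f j ≈ g j) → ∀ m → ∑ f m ≈ ∑ g m
  ∑-cong f≈g zero    = f≈g zero
  ∑-cong f≈g (suc m) = +-cong (∑-cong f≈g m) (f≈g (suc m))

  ∑-head : ∀ f → (∀ j → f (suc j) ≈ 0#) → ∀ m → ∑ f m ≈ f zero
  ∑-head f tail≈0 zero    = refl
  ∑-head f tail≈0 (suc m) = trans (+-cong (∑-head f tail≈0 m) (tail≈0 m)) (+-identityʳ _)

  ∑-suc : ∀ f m → ∑ f (suc m) ≈ f zero + ∑ (f ∘ suc) m
  ∑-suc f zero    = refl
  ∑-suc f (suc m) = trans (+-congʳ (∑-suc f m)) (+-assoc _ _ _)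

  *-distribˡ-∑ : ∀ a f m → a * ∑ f m ≈ ∑ (λ j → a * f j) m
  *-distribˡ-∑ a f zero    = refl
  *-distribˡ-∑ a f (suc m) = trans (distribˡ a _ _) (+-congʳ (*-distribˡ-∑ a f m))

  ∑-+ : ∀ f g m → ∑ (λ j → f j + g j) m ≈ ∑ f m + ∑ g m
  ∑-+ f g zero    = refl
  ∑-+ f g (suc m) = trans (+-congʳ (∑-+ f g m)) (+-interchange _ _ _ _)

  poly : (ℕ → Carrier) → ℕ → Carrier → Carrier
  poly c m u = ∑ (λ j → c j * u ^ j) m

  poly-cong : ∀ {c d} → (∀ j → c j ≈ d j) → ∀ m u → poly c m u ≈ poly d m u
  poly-cong c≈d m u = ∑-cong (λ j → *-congʳ (c≈d j)) m

  poly-+ : ∀ c d m u → poly (λ j → c j + d j) m u ≈ poly c m u + poly d m u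
  poly-+ c d m u = trans (∑-cong (λ j → distribʳ (u ^ j) (c j) (d j)) m) (∑-+ _ _ m)

  poly-* : ∀ a c m u → poly (λ j → a * c j) m u ≈ a * poly c m u
  poly-* a c m u = trans (∑-cong (λ j → *-assoc a (c j) (u ^ j)) m) (sym (*-distribˡ-∑ a _ m))

  poly-drop-top : ∀ {c} m u → c (suc m) ≈ 0# → poly c (suc m) u ≈ poly c m u
  poly-drop-top m u top≈0 = trans (+-congˡ (x≈0⇒x*y≈0 top≈0)) (+-identityʳ _)

  poly-at-zero : ∀ c m {u} → u ≈ 0# → poly c m u ≈ c 0
  poly-at-zero c m u≈0 = trans (∑-head _ (λ j → y≈0⇒x*y≈0 (x≈0⇒x*y≈0 u≈0)) m) (*-identityʳ _)

  D : (ℕ → Carrier) → ℕ → Carrier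
  D c j = N (suc j) * c (suc j)

  euler : ∀ c m u → u * poly (D c) m u ≈ poly (λ j → N j * c j) (suc m) u
  euler c zero    u =
    solve 3 (λ u c₀ c₁ → let n₁ = con 1 :+ con 0 in
                         u :* (n₁ :* c₁ :* con 1) := con 0 :* c₀ :* con 1 :+ n₁ :* c₁ :* (u :* con 1))
            refl u (c 0) (c 1)
  euler c (suc m) u = trans (distribˡ u _ _) (+-cong (euler c m u) (*-exchangeˡ u _ _))

  DegreeAtMost : ℕ → (ℕ → Carrier) → Set ℓ
  DegreeAtMost n c = ∀ j → n < j → c j ≈ 0#

  degree-suc : ∀ {m c} → DegreeAtMost m c → DegreeAtMost (suc m) c
  degree-suc deg j m<j = deg j (ℕₚ.<-trans (ℕₚ.n<1+n _) m<j)

  D-degree : ∀ {m c} → DegreeAtMost (suc m) c → DegreeAtMost m (D c)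
  D-degree deg j m<j = y≈0⇒x*y≈0 (deg (suc j) (s≤s m<j))

  -- Kummer's equation

  -- The coefficientwise form of u y'' + (β + 1 + u) y' = μ y for y = poly c (see kummer-ode),
  -- i.e. Kummer's equation in the variable -u.
  Kummer : Carrier → Carrier → (ℕ → Carrier) → Set ℓ
  Kummer β μ c = ∀ j → N (suc j) * (N (suc j) + β) * c (suc j) + N j * c j ≈ μ * c j

  kummer-D : ∀ {β μ c} → Kummer β (1# + μ) c → Kummer (β + 1#) μ (D c)
  kummer-D {β} {μ} {c} kummer j = +-cancelʳ (N (suc j) * c₁) _ _ (begin
    N (suc j) * (N (suc j) + (β + 1#)) * (N (suc (suc j)) * c₂) + N j * (N (suc j) * c₁)
      + N (suc j) * c₁
      ≈⟨ solve 4 (λ n β c₁ c₂ → let n₁ = con 1 :+ n; n₂ = con 1 :+ n₁ in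
                    n₁ :* (n₁ :+ (β :+ con 1)) :* (n₂ :* c₂) :+ n :* (n₁ :* c₁) :+ n₁ :* c₁
                    := n₁ :* (n₂ :* (n₂ :+ β) :* c₂ :+ n₁ :* c₁))
                 refl (N j) β c₁ c₂ ⟩
    N (suc j) * (N (suc (suc j)) * (N (suc (suc j)) + β) * c₂ + N (suc j) * c₁)
      ≈⟨ *-congˡ (kummer (suc j)) ⟩
    N (suc j) * ((1# + μ) * c₁)
      ≈⟨ solve 3 (λ n μ c₁ → let n₁ = con 1 :+ n in
                    n₁ :* ((con 1 :+ μ) :* c₁) := μ :* (n₁ :* c₁) :+ n₁ :* c₁)
                 refl (N j) μ c₁ ⟩
    μ * (N (suc j) * c₁) + N (suc j) * c₁ ∎)
    where
    c₁ c₂ : Carrier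
    c₁ = c (suc j)
    c₂ = c (suc (suc j))

  kummer-ode : ∀ {β μ c m} → Kummer β μ c → DegreeAtMost m c → ∀ u →
               u * poly (D (D c)) m u + (β + 1# + u) * poly (D c) m u ≈ μ * poly c m u
  kummer-ode {β} {μ} {c} {m} kummer deg u = begin
    u * poly (D (D c)) m u + (β + 1# + u) * poly (D c) m u
      ≈⟨ +-congˡ (distribʳ _ _ _) ⟩
    u * poly (D (D c)) m u + ((β + 1#) * poly (D c) m u + u * poly (D c) m u)
      ≈⟨ +-cong (euler (D c) m u) (+-congˡ (euler c m u)) ⟩
    poly (λ j → N j * D c j) (suc m) u
      + ((β + 1#) * poly (D c) m u + poly (λ j → N j * c j) (suc m) u)
      ≈⟨ +-cong (poly-drop-top m u (y≈0⇒x*y≈0 (D-degree (degree-suc deg) (suc m) (ℕₚ.n<1+n m))))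
                (+-congˡ (poly-drop-top m u (y≈0⇒x*y≈0 (deg (suc m) (ℕₚ.n<1+n m))))) ⟩
    poly (λ j → N j * D c j) m u + ((β + 1#) * poly (D c) m u + poly (λ j → N j * c j) m u)
      ≈⟨ +-congˡ (+-congʳ (poly-* (β + 1#) (D c) m u)) ⟨
    poly (λ j → N j * D c j) m u
      + (poly (λ j → (β + 1#) * D c j) m u + poly (λ j → N j * c j) m u)
      ≈⟨ trans (poly-+ _ _ m u) (+-congˡ (poly-+ _ _ m u)) ⟨
    poly (λ j → N j * D c j + ((β + 1#) * D c j + N j * c j)) m u
      ≈⟨ poly-cong (λ j → trans (regroup j) (kummer j)) m u ⟩
    poly (λ j → μ * c j) m u
      ≈⟨ poly-* μ c m u ⟩
    μ * poly c m u ∎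
    where
    regroup : ∀ j → N j * D c j + ((β + 1#) * D c j + N j * c j)
                    ≈ N (suc j) * (N (suc j) + β) * c (suc j) + N j * c j
    regroup j = solve 4 (λ n β c₀ c₁ → let n₁ = con 1 :+ n in
                           n :* (n₁ :* c₁) :+ ((β :+ con 1) :* (n₁ :* c₁) :+ n :* c₀)
                           := n₁ :* (n₁ :+ β) :* c₁ :+ n :* c₀)
                        refl (N j) β (c j) (c (suc j))

  ev : Expr → Carrier → Carrier → Carrier
  ev = eval K

  ev-sumUpTo : ∀ F m x t → ev (sumUpTo F m) x t ≡ ∑ (λ j → ev (F j) x t) m
  ev-sumUpTo F zero    x t = ≡.refl
  ev-sumUpTo F (suc m) x t = ≡.cong (_+ ev (F (suc m)) x t) (ev-sumUpTo F m x t)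

  ev-powE : ∀ e j x t → ev (powE e j) x t ≈ ev e x t ^ j
  ev-powE e zero    x t = +-identityʳ 1#
  ev-powE e (suc j) x t = trans (*-congʳ (ev-powE e j x t)) (*-comm _ _)

  ev-∂-powE : ∀ {∂} → IsDerivation ∂ → ∀ e j x t →
              ev (∂ (powE e (suc j))) x t ≈ N (suc j) * ev e x t ^ j * ev (∂ e) x t
  ev-∂-powE {∂} isD e zero x t = begin
    ev (∂ (con 1 ⊗ e)) x t             ≡⟨ ≡.cong (λ z → ev z x t) (∂-⊗ (con 1) e) ⟩
    ev (∂ (con 1)) x t * E + N 1 * E′  ≡⟨ ≡.cong (λ z → ev z x t * E + N 1 * E′) (∂-con 1) ⟩
    0# * E + N 1 * E′                  ≈⟨ solve 2 (λ E E′ → let n₁ = con 1 :+ con 0 in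
                                                     con 0 :* E :+ n₁ :* E′ := n₁ :* con 1 :* E′)
                                                  refl E E′ ⟩
    N 1 * 1# * E′                      ∎
    where
    open IsDerivation isD
    E E′ : Carrier
    E  = ev e x t
    E′ = ev (∂ e) x t
  ev-∂-powE {∂} isD e (suc j) x t = begin
    ev (∂ (powE e (suc j) ⊗ e)) x t
      ≡⟨ ≡.cong (λ z → ev z x t) (∂-⊗ (powE e (suc j)) e) ⟩
    ev (∂ (powE e (suc j))) x t * E + ev (powE e (suc j)) x t * E′
      ≈⟨ +-cong (*-congʳ (ev-∂-powE isD e j x t)) (*-congʳ (ev-powE e (suc j) x t)) ⟩
    N (suc j) * E ^ j * E′ * E + E ^ suc j * E′
      ≈⟨ solve 4 (λ n E p E′ → (con 1 :+ n) :* p :* E′ :* E :+ (E :* p) :* E′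
                               := (con 1 :+ (con 1 :+ n)) :* (E :* p) :* E′)
                 refl (N j) E (E ^ j) E′ ⟩
    N (suc (suc j)) * E ^ suc j * E′ ∎
    where
    open IsDerivation isD
    E E′ : Carrier
    E  = ev e x t
    E′ = ev (∂ e) x t

  ev-∂t-powE-negX : ∀ j x t → ev (∂t (powE (neg varX) j)) x t ≈ 0#
  ev-∂t-powE-negX zero    x t = refl
  ev-∂t-powE-negX (suc j) x t =
    trans (ev-∂-powE ∂t-isDerivation (neg varX) j x t) (y≈0⇒x*y≈0 -0#≈0#)

  ev-∂x-prodShift : ∀ j m x t → ev (∂x (prodShift j m)) x t ≈ 0#
  ev-∂x-prodShift j zero    x t = refl
  ev-∂x-prodShift j (suc m) x t =
    trans (+-cong (x≈0⇒x*y≈0 (ev-∂x-prodShift j m x t)) (y≈0⇒x*y≈0 (+-identityʳ 0#)))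
          (+-identityʳ 0#)

  prodShift-suc : ∀ j m x t →
                  ev (prodShift j (suc m)) x t ≈ (t + N (suc j)) * ev (prodShift (suc j) m) x t
  prodShift-suc j zero    x t =
    trans (*-comm _ _) (*-congʳ (+-congˡ (reflexive (≡.cong N (ℕₚ.+-comm j 1)))))
  prodShift-suc j (suc m) x t = begin
    ev (prodShift j (suc m)) x t * (t + N (j ℕ.+ suc (suc m)))
      ≈⟨ *-cong (prodShift-suc j m x t) (+-congˡ (reflexive (≡.cong N (ℕₚ.+-suc j (suc m))))) ⟩
    (t + N (suc j)) * ev (prodShift (suc j) m) x t * (t + N (suc j ℕ.+ suc m))
      ≈⟨ *-assoc _ _ _ ⟩
    (t + N (suc j)) * ev (prodShift (suc j) (suc m)) x t ∎

  -- The Laguerre curve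

  -- The coefficient of (-x)ʲ in L n, evaluated at (x, t); it does not depend on x, but nothing
  -- below needs that.
  laguerre-coeff : ℕ → Carrier → Carrier → ℕ → Carrier
  laguerre-coeff n x t j = N (n C j) * ev (prodShift j (n ∸ j)) x t

  laguerre-degree : ∀ n x t → DegreeAtMost n (laguerre-coeff n x t)
  laguerre-degree n x t j n<j = x≈0⇒x*y≈0 (reflexive (≡.cong N (k>n⇒nCk≡0 n<j)))

  N-binomial-recurrence : ∀ n j → N (suc j) * N (n C suc j) + N j * N (n C j) ≈ N n * N (n C j)
  N-binomial-recurrence n j = begin
    N (suc j) * N (n C suc j) + N j * N (n C j)
      ≈⟨ +-cong (N-* (suc j) (n C suc j)) (N-* j (n C j)) ⟨
    N (suc j ℕ.* (n C suc j)) + N (j ℕ.* (n C j))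
      ≈⟨ N-+ (suc j ℕ.* (n C suc j)) (j ℕ.* (n C j)) ⟨
    N (suc j ℕ.* (n C suc j) ℕ.+ j ℕ.* (n C j))
      ≡⟨ ≡.cong N (binomial-recurrence n j) ⟩
    N (n ℕ.* (n C j))
      ≈⟨ N-* n (n C j) ⟩
    N n * N (n C j) ∎

  laguerre-kummer : ∀ n x t → Kummer t (N n) (laguerre-coeff n x t)
  laguerre-kummer n x t j with j <? n
  ... | yes j<n = begin
    N (suc j) * (N (suc j) + t) * (C₁ * P₁) + N j * (C₀ * P₀)
      ≈⟨ +-congˡ (*-congˡ (*-congˡ P₀≈)) ⟩
    N (suc j) * (N (suc j) + t) * (C₁ * P₁) + N j * (C₀ * ((t + N (suc j)) * P₁))
      ≈⟨ solve 6 (λ n₁ t C₁ P₁ n C₀ →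
                    n₁ :* (n₁ :+ t) :* (C₁ :* P₁) :+ n :* (C₀ :* ((t :+ n₁) :* P₁))
                    := (n₁ :* C₁ :+ n :* C₀) :* ((t :+ n₁) :* P₁))
                 refl (N (suc j)) t C₁ P₁ (N j) C₀ ⟩
    (N (suc j) * C₁ + N j * C₀) * ((t + N (suc j)) * P₁)
      ≈⟨ *-congʳ (N-binomial-recurrence n j) ⟩
    N n * C₀ * ((t + N (suc j)) * P₁)
      ≈⟨ *-assoc _ _ _ ⟩
    N n * (C₀ * ((t + N (suc j)) * P₁))
      ≈⟨ *-congˡ (*-congˡ P₀≈) ⟨
    N n * (C₀ * P₀) ∎
    where
    C₀ C₁ P₀ P₁ : Carrier
    C₀ = N (n C j)
    C₁ = N (n C suc j)
    P₀ = ev (prodShift j (n ∸ j)) x t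
    P₁ = ev (prodShift (suc j) (n ∸ suc j)) x t
    P₀≈ : P₀ ≈ (t + N (suc j)) * P₁
    P₀≈ = trans (reflexive (≡.cong (λ m → ev (prodShift j m) x t) (ℕₚ.+-∸-assoc 1 j<n)))
                (prodShift-suc j (n ∸ suc j) x t)
  ... | no j≮n = begin
    N (suc j) * (N (suc j) + t) * (C₁ * P₁) + N j * (C₀ * P₀)
      ≈⟨ +-congʳ (y≈0⇒x*y≈0 (x≈0⇒x*y≈0 C₁≈0)) ⟩
    0# + N j * (C₀ * P₀)
      ≈⟨ trans (+-identityˡ _) (sym (*-assoc _ _ _)) ⟩
    N j * C₀ * P₀
      ≈⟨ *-congʳ jC₀≈nC₀ ⟩
    N n * C₀ * P₀
      ≈⟨ *-assoc _ _ _ ⟩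
    N n * (C₀ * P₀) ∎
    where
    C₀ C₁ P₀ P₁ : Carrier
    C₀ = N (n C j)
    C₁ = N (n C suc j)
    P₀ = ev (prodShift j (n ∸ j)) x t
    P₁ = ev (prodShift (suc j) (n ∸ suc j)) x t
    C₁≈0 : C₁ ≈ 0#
    C₁≈0 = reflexive (≡.cong N (k>n⇒nCk≡0 (s≤s (ℕₚ.≮⇒≥ j≮n))))
    jC₀≈nC₀ : N j * C₀ ≈ N n * C₀
    jC₀≈nC₀ = begin
      N j * C₀                   ≈⟨ +-identityˡ _ ⟨
      0# + N j * C₀              ≈⟨ +-congʳ (y≈0⇒x*y≈0 C₁≈0) ⟨
      N (suc j) * C₁ + N j * C₀  ≈⟨ N-binomial-recurrence n j ⟩
      N n * C₀                   ∎

  ev-Lterm : ∀ n j x t → ev (Lterm n j) x t ≈ laguerre-coeff n x t j * (- x) ^ j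
  ev-Lterm n j x t =
    trans (*-congʳ (*-congʳ (ev-powE (neg varX) j x t)))
          (solve 3 (λ q C P → q :* C :* P := C :* P :* q)
                   refl ((- x) ^ j) (N (n C j)) (ev (prodShift j (n ∸ j)) x t))

  ev-L : ∀ n x t → ev (L n) x t ≈ poly (laguerre-coeff n x t) n (- x)
  ev-L n x t = trans (reflexive (ev-sumUpTo (Lterm n) n x t)) (∑-cong (λ j → ev-Lterm n j x t) n)

  ev-∂x-Lterm-zero : ∀ n x t → ev (∂x (Lterm n 0)) x t ≈ 0#
  ev-∂x-Lterm-zero n x t =
    trans (+-congˡ (*-congˡ (ev-∂x-prodShift 0 n x t)))
          (solve 2 (λ C P → let n₁ = con 1 :+ con 0 in
                            (con 0 :* C :+ n₁ :* con 0) :* P :+ n₁ :* C :* con 0 := con 0)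
                   refl (N (n C 0)) (ev (prodShift 0 n) x t))

  ev-∂x-Lterm-suc : ∀ n j x t →
                    ev (∂x (Lterm n (suc j))) x t ≈ - N 1 * (D (laguerre-coeff n x t) j * (- x) ^ j)
  ev-∂x-Lterm-suc n j x t =
    trans (+-cong (*-congʳ (+-congʳ (*-congʳ (ev-∂-powE ∂x-isDerivation (neg varX) j x t))))
                  (*-congˡ (ev-∂x-prodShift (suc j) (n ∸ suc j) x t)))
          (solve 6 (λ n₁ q s C P p → (n₁ :* q :* s :* C :+ p :* con 0) :* P :+ p :* C :* con 0
                                     := s :* (n₁ :* (C :* P) :* q))
                   refl (N (suc j)) ((- x) ^ j) (- N 1) (N (n C suc j))
                        (ev (prodShift (suc j) (n ∸ suc j)) x t) (ev (powE (neg varX) (suc j)) x t))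

  ev-∂x-L : ∀ n x t → ev (∂x (L n)) x t ≈ - N 1 * poly (D (laguerre-coeff n x t)) n (- x)
  ev-∂x-L n x t = begin
    ev (∂x (L n)) x t
      ≡⟨ ≡.cong (λ e → ev e x t) (∂-sumUpTo ∂x-isDerivation (Lterm n) n) ⟩
    ev (sumUpTo (∂x ∘ Lterm n) n) x t
      ≡⟨ ev-sumUpTo (∂x ∘ Lterm n) n x t ⟩
    ∑ f n
      ≈⟨ trans (+-congˡ f-top≈0) (+-identityʳ _) ⟨
    ∑ f (suc n)
      ≈⟨ ∑-suc f n ⟩
    f 0 + ∑ (f ∘ suc) n
      ≈⟨ +-cong (ev-∂x-Lterm-zero n x t) (∑-cong (λ j → ev-∂x-Lterm-suc n j x t) n) ⟩
    0# + ∑ (λ j → - N 1 * (D a j * (- x) ^ j)) n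
      ≈⟨ +-identityˡ _ ⟩
    ∑ (λ j → - N 1 * (D a j * (- x) ^ j)) n
      ≈⟨ *-distribˡ-∑ (- N 1) _ n ⟨
    - N 1 * poly (D a) n (- x) ∎
    where
    a f : ℕ → Carrier
    a = laguerre-coeff n x t
    f j = ev (∂x (Lterm n j)) x t
    f-top≈0 : f (suc n) ≈ 0#
    f-top≈0 = trans (ev-∂x-Lterm-suc n n x t)
                    (y≈0⇒x*y≈0 (x≈0⇒x*y≈0 (y≈0⇒x*y≈0 (laguerre-degree n x t (suc n) (ℕₚ.n<1+n n)))))

  ev-∂t-Lterm : ∀ n j x t →
                ev (∂t (Lterm n j)) x t ≈ N (n C j) * ev (∂t (prodShift j (n ∸ j))) x t * (- x) ^ j
  ev-∂t-Lterm n j x t =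
    trans (+-cong (*-congʳ (+-cong (*-congʳ (ev-∂t-powE-negX j x t)) (*-congʳ (ev-powE (neg varX) j x t))))
                  (*-congʳ (*-congʳ (ev-powE (neg varX) j x t))))
          (solve 4 (λ q C P Q → (con 0 :* C :+ q :* con 0) :* P :+ q :* C :* Q := C :* Q :* q)
                   refl ((- x) ^ j) (N (n C j)) (ev (prodShift j (n ∸ j)) x t)
                        (ev (∂t (prodShift j (n ∸ j))) x t))

  ev-∂t-L : ∀ n x t →
            ev (∂t (L n)) x t ≈ poly (λ j → N (n C j) * ev (∂t (prodShift j (n ∸ j))) x t) n (- x)
  ev-∂t-L n x t = begin
    ev (∂t (L n)) x t
      ≡⟨ ≡.cong (λ e → ev e x t) (∂-sumUpTo ∂t-isDerivation (Lterm n) n) ⟩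
    ev (sumUpTo (∂t ∘ Lterm n) n) x t
      ≡⟨ ev-sumUpTo (∂t ∘ Lterm n) n x t ⟩
    ∑ (λ j → ev (∂t (Lterm n j)) x t) n
      ≈⟨ ∑-cong (λ j → ev-∂t-Lterm n j x t) n ⟩
    poly (λ j → N (n C j) * ev (∂t (prodShift j (n ∸ j))) x t) n (- x) ∎

  module _ (isField : IsField K) where
    open IsField isField

    *-cancelˡ-≈0 : ∀ {a b} → ¬ a ≈ 0# → a * b ≈ 0# → b ≈ 0#
    *-cancelˡ-≈0 {a} {b} a≉0 ab≈0 with inverse a a≉0
    ... | a⁻¹ , aa⁻¹≈1 = begin
      b              ≈⟨ *-identityˡ b ⟨
      1# * b         ≈⟨ *-congʳ (trans (sym aa⁻¹≈1) (*-comm a a⁻¹)) ⟩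
      a⁻¹ * a * b    ≈⟨ *-assoc a⁻¹ a b ⟩
      a⁻¹ * (a * b)  ≈⟨ y≈0⇒x*y≈0 ab≈0 ⟩
      0#             ∎

    *-cancelʳ-≈0 : ∀ {a b} → ¬ a ≈ 0# → b * a ≈ 0# → b ≈ 0#
    *-cancelʳ-≈0 a≉0 ba≈0 = *-cancelˡ-≈0 a≉0 (trans (*-comm _ _) ba≈0)

    *-≉0 : ∀ {a b} → ¬ a ≈ 0# → ¬ b ≈ 0# → ¬ a * b ≈ 0#
    *-≉0 a≉0 b≉0 ab≈0 = b≉0 (*-cancelˡ-≈0 a≉0 ab≈0)

    module _ (charZero : CharZero K) where

      kummer-no-double-root : ∀ n {β c u} → Kummer β (N n) c → DegreeAtMost n c → ¬ c n ≈ 0# →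
                              ¬ u ≈ 0# → poly c n u ≈ 0# → ¬ poly (D c) n u ≈ 0#
      kummer-no-double-root zero    _ _ top≉0 _ y≈0 _ = top≉0 (trans (sym (*-identityʳ _)) y≈0)
      kummer-no-double-root (suc m) {β} {c} {u} kummer deg top≉0 u≉0 y≈0 y′≈0 =
        kummer-no-double-root m (kummer-D kummer) (D-degree deg) (*-≉0 (charZero m) top≉0) u≉0
          (drop-top (D-degree deg) y′≈0) (drop-top (D-degree (degree-suc (D-degree deg))) y″≈0)
        where
        drop-top : ∀ {d} → DegreeAtMost m d → poly d (suc m) u ≈ 0# → poly d m u ≈ 0#
        drop-top deg-d = trans (sym (poly-drop-top m u (deg-d (suc m) (ℕₚ.n<1+n m))))
        y″≈0 : poly (D (D c)) (suc m) u ≈ 0#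
        y″≈0 = *-cancelˡ-≈0 u≉0 (begin
          u * poly (D (D c)) (suc m) u
            ≈⟨ +-identityʳ _ ⟨
          u * poly (D (D c)) (suc m) u + 0#
            ≈⟨ +-congˡ (y≈0⇒x*y≈0 y′≈0) ⟨
          u * poly (D (D c)) (suc m) u + (β + 1# + u) * poly (D c) (suc m) u
            ≈⟨ kummer-ode kummer deg u ⟩
          N (suc m) * poly c (suc m) u
            ≈⟨ y≈0⇒x*y≈0 y≈0 ⟩
          0# ∎)

      distinct-shifts : ∀ {a b t} → b < a → t + N a ≈ 0# → ¬ t + N b ≈ 0#
      distinct-shifts {a} {b} {t} b<a ta≈0 tb≈0 with ℕₚ.m≤n⇒∃[o]m+o≡n b<a
      ... | o , b+1+o≡a = charZero o (begin
        N (suc o)               ≈⟨ +-identityˡ _ ⟨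
        0# + N (suc o)          ≈⟨ +-congʳ tb≈0 ⟨
        t + N b + N (suc o)     ≈⟨ +-assoc t (N b) (N (suc o)) ⟩
        t + (N b + N (suc o))   ≈⟨ +-congˡ (N-+ b (suc o)) ⟨
        t + N (b ℕ.+ suc o)     ≡⟨ ≡.cong (λ k → t + N k) (≡.trans (ℕₚ.+-suc b o) b+1+o≡a) ⟩
        t + N a                 ≈⟨ ta≈0 ⟩
        0#                      ∎)

      prodShift-nonzero : ∀ j m {a x t} → j ℕ.+ m < a → t + N a ≈ 0# → ¬ ev (prodShift j m) x t ≈ 0#
      prodShift-nonzero j zero    _     _    = charZero 0
      prodShift-nonzero j (suc m) j+m<a ta≈0 =
        *-≉0 (prodShift-nonzero j m (ℕₚ.<-trans (ℕₚ.+-monoʳ-< j (ℕₚ.n<1+n m)) j+m<a) ta≈0)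
             (distinct-shifts j+m<a ta≈0)

      prodShift-simple-roots : ∀ j m x t →
                               ¬ (ev (prodShift j m) x t ≈ 0# × ev (∂t (prodShift j m)) x t ≈ 0#)
      prodShift-simple-roots j zero    x t (P≈0 , _)     = charZero 0 P≈0
      prodShift-simple-roots j (suc m) x t (P≈0 , P′≈0) = ¬¬-excluded-middle λ
        { (yes f≈0) → prodShift-nonzero j m (ℕₚ.+-monoʳ-< j (ℕₚ.n<1+n m)) f≈0 (begin
            Pₘ
              ≈⟨ solve 3 (λ P Q f → P := Q :* con 0 :+ P :* ((con 1 :+ con 0) :+ con 0))
                         refl Pₘ P′ₘ f ⟩
            P′ₘ * 0# + Pₘ * ((1# + 0#) + 0#)
              ≈⟨ +-congʳ (*-congˡ f≈0) ⟨
            ev (∂t (prodShift j (suc m))) x t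
              ≈⟨ P′≈0 ⟩
            0# ∎)
        ; (no f≉0) → let Pₘ≈0 = *-cancelʳ-≈0 f≉0 P≈0 in
            prodShift-simple-roots j m x t (Pₘ≈0 , *-cancelʳ-≈0 f≉0 (begin
              P′ₘ * f                            ≈⟨ +-identityʳ _ ⟨
              P′ₘ * f + 0#                       ≈⟨ +-congˡ (x≈0⇒x*y≈0 Pₘ≈0) ⟨
              ev (∂t (prodShift j (suc m))) x t  ≈⟨ P′≈0 ⟩
              0#                                 ∎)) }
        where
        Pₘ P′ₘ f : Carrier
        Pₘ  = ev (prodShift j m) x t
        P′ₘ = ev (∂t (prodShift j m)) x t
        f   = t + N (j ℕ.+ suc m)

      laguerre-top : ∀ n x t → ¬ laguerre-coeff n x t n ≈ 0#
      laguerre-top n x t aₙ≈0 = *-≉0 (charZero 0) (charZero 0) (trans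
        (reflexive (≡.cong₂ (λ k m → N k * ev (prodShift n m) x t) (≡.sym (nCn≡1 n)) (≡.sym (ℕₚ.n∸n≡0 n))))
        aₙ≈0)

      laguerre-smooth-off-axis : ∀ n {x t} → ¬ x ≈ 0# → ev (L n) x t ≈ 0# → ¬ ev (∂x (L n)) x t ≈ 0#
      laguerre-smooth-off-axis n {x} {t} x≉0 L≈0 ∂xL≈0 =
        kummer-no-double-root n (laguerre-kummer n x t) (laguerre-degree n x t) (laguerre-top n x t)
          (-‿≉0 x≉0)
          (trans (sym (ev-L n x t)) L≈0)
          (*-cancelˡ-≈0 (-‿≉0 (charZero 0)) (trans (sym (ev-∂x-L n x t)) ∂xL≈0))

      laguerre-smooth-on-axis : ∀ n {x t} → x ≈ 0# → ev (L n) x t ≈ 0# → ¬ ev (∂t (L n)) x t ≈ 0#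
      laguerre-smooth-on-axis n {x} {t} x≈0 L≈0 ∂tL≈0 = prodShift-simple-roots 0 n x t
        ( constant-term (λ j → ev (prodShift j (n ∸ j)) x t) (ev-L n x t) L≈0
        , constant-term (λ j → ev (∂t (prodShift j (n ∸ j))) x t) (ev-∂t-L n x t) ∂tL≈0 )
        where
        constant-term : ∀ g {E} → E ≈ poly (λ j → N (n C j) * g j) n (- x) → E ≈ 0# → g 0 ≈ 0#
        constant-term g {E} E≈g E≈0 = begin
          g 0                                    ≈⟨ N1*-identity (g 0) ⟨
          N (n C 0) * g 0                        ≈⟨ poly-at-zero _ n (trans (-‿cong x≈0) -0#≈0#) ⟨
          poly (λ j → N (n C j) * g j) n (- x)   ≈⟨ E≈g ⟨
          E                                      ≈⟨ E≈0 ⟩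
          0#                                     ∎

lemma13 : ∀ {c ℓ} (K : CommutativeRing c ℓ) → IsField K → CharZero K → IsAlgClosed K →
    (n : ℕ) → 3 ≤ n →
    ∀ x t → ¬ SingularPoint K (L n) x t
lemma13 K isField charZero _ n _ x t (L≈0 , ∂xL≈0 , ∂tL≈0) = ¬¬-excluded-middle λ
  { (yes x≈0) → laguerre-smooth-on-axis K isField charZero n x≈0 L≈0 ∂tL≈0
  ; (no x≉0)  → laguerre-smooth-off-axis K isField charZero n x≉0 L≈0 ∂xL≈0 }
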